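{- Let $n\ge1$ and let $(h_S)_{S\subseteq[n-1]}$ be the flag $h$-vector of an Eulerian poset of rank $n$, or more generally any vector lying in the generalized Dehn–Sommerville subspace. Let $T\subseteq[n-1]$ be such that $T$ contains an interval $[s,t]=\{s,s+1,\dots,t\}$ of odd cardinality with $s-1\notin T$ and $t+1\notin T$. Then $$\sum_{S\subseteq[n-1]}(-1)^{|S\cap T|}\cdot h_S=0.$$
   Context: For a graded poset $P$ of rank $n$ with $\hat0,\hat1$ and rank function $\rho$, and $S=\{s_1<\cdots<s_{m-1}\}\subseteq[n-1]$, $f_S$ is the number of chains $\hat0=x_0<x_1<\cdots<x_m=\hat1$ with $\rho(x_i)=s_i$ ($1\le i\le m-1$), and the flag $h$-vector is $h_S=\sum_{T\subseteq S}(-1)^{|S-T|}f_T$. A graded poset is Eulerian if every nontrivial interval has equally many elements of even and odd rank. For non-commuting variables $\mathbf a,\mathbf b$ and $S\subseteq[n-1]$, let $u_S=u_1\cdots u_{n-1}$ with $u_i=\mathbf b$ if $i\in S$ and $u_i=\mathbf a$ otherwise. The generalized Dehn–Sommerville subspace is the set of vectors $(h_S)_{S\subseteq[n-1]}$ (with integer or real entries) such that $\sum_S h_S u_S$ can be written as a polynomial in $\mathbf c=\mathbf a+\mathbf b$ and $\mathbf d=\mathbf a\mathbf b+\mathbf b\mathbf a$; flag $h$-vectors of Eulerian posets lie in it.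
   Formalization: Vectors in the generalized Dehn–Sommerville subspace, and the coefficients of their cd-polynomials, are taken over ℚ rather than the reals. -}

module Defs where

open import Data.Bool using (Bool; true; false)
import Data.Bool as B
open import Data.Nat as ℕ using (ℕ; zero; suc)
open import Data.List using (List; []; _∷_; _++_; map; foldr; length; filter)
open import Data.List.Properties using (≡-dec)
open import Data.Vec using (Vec; []; _∷_; toList)
open import Data.Fin.Subset using (Subset)
open import Data.Rational using (ℚ; 0ℚ; 1ℚ; -_; _+_; _*_; _/_)
open import Data.Integer using (+_)
open import Data.Product using (Σ; _×_; _,_)
open import Relation.Nullary using (¬_)
open import Relation.Binary.PropositionalEquality using (_≡_)

-- Subsets S ⊆ [m] are 'Subset m = Vec Bool m'; position i (0-based)
-- corresponds to the element i+1 of [m] = {1,…,m}.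

-- Membership of a natural number k in T ⊆ [m] (false for k = 0 or k > m).
elem : ∀ {m} → Subset m → ℕ → Bool
elem []      _             = false
elem (x ∷ T) zero          = false
elem (x ∷ T) (suc zero)    = x
elem (x ∷ T) (suc (suc k)) = elem T (suc k)

allSubsets : ∀ m → List (Subset m)
allSubsets zero    = [] ∷ []
allSubsets (suc m) = map (false ∷_) (allSubsets m) ++ map (true ∷_) (allSubsets m)

sumℚ : List ℚ → ℚ
sumℚ = foldr _+_ 0ℚ

sgn : ℕ → ℚ
sgn zero    = 1ℚ
sgn (suc k) = - sgn k

-- ab-words: lists of letters, false = a, true = b.
ABWord : Set
ABWord = List Bool

uS : ∀ {m} → Subset m → ABWord
uS = toList

data CD : Set where
  c d : CD

CDWord : Set
CDWord = List CD

-- Expansion of a cd-word into a sum of ab-words (as a list, with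
-- multiplicity), substituting c = a + b and d = ab + ba.
expand : CDWord → List ABWord
expand []      = [] ∷ []
expand (c ∷ w) = map (false ∷_) (expand w) ++ map (true ∷_) (expand w)
expand (d ∷ w) = map (λ u → false ∷ true ∷ u) (expand w)
              ++ map (λ u → true ∷ false ∷ u) (expand w)

occ : ABWord → List ABWord → ℕ
occ u vs = length (filter (λ v → ≡-dec B._≟_ v u) vs)

CDPoly : Set
CDPoly = List (ℚ × CDWord)

coeffAB : CDPoly → ABWord → ℚ
coeffAB []             u = 0ℚ
coeffAB ((q , w) ∷ ps) u = q * (+ occ u (expand w) / 1) + coeffAB ps u

-- The generalized Dehn–Sommerville subspace (over ℚ): the vector
-- (h_S)_{S ⊆ [m]} (with m = n-1) such that Σ_S h_S u_S equals, as a
-- non-commutative polynomial in a,b, the expansion of some cd-polynomial.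
InGDS : ∀ m → (Subset m → ℚ) → Set
InGDS m h = Σ CDPoly λ P →
  ((S : Subset m) → coeffAB P (uS S) ≡ h S) ×
  ((u : ABWord) → ¬ (length u ≡ m) → coeffAB P u ≡ 0ℚ)

-- Substitute a ↦ 1 and, at position i, b ↦ (−1)^[i ∈ T] in the ab-expansion of
-- Σ_S h_S u_S: the result is exactly Σ_S (−1)^|S ∩ T| h_S.  Under this substitution
-- c = a + b at position i becomes 1 + (−1)^[i ∈ T], which vanishes for i ∈ T, and
-- d = ab + ba at positions i, i+1 becomes (−1)^[i+1 ∈ T] + (−1)^[i ∈ T], which vanishes
-- when exactly one of i, i+1 lies in T.  Reading a cd-monomial of degree n − 1 from the
-- left, some letter must hit the isolated run [s, t]: a c inside it, or a d straddling
-- one of its ends; otherwise d's would tile the run, whose length is odd.  So every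
-- cd-monomial, and hence the whole sum, is sent to 0.

module Submission where

open import Algebra.Bundles using (CommutativeMonoid)
open import Data.Bool as Bool using (Bool; true; false; not; if_then_else_)
open import Data.Fin.Subset using (Subset; _∩_; ∣_∣)
open import Data.Integer as ℤ using (+_)
open import Data.Integer.Solver renaming (module +-*-Solver to ℤ-Solver)
open import Data.List using (List; []; _∷_; _++_; map)
open import Data.List.Properties using (≡-dec; map-∘; map-cong)
open import Data.Nat using (ℕ; zero; suc; z≤n; s≤s; _≤_; _∸_; _*_; pred)
import Data.Nat.Properties as ℕ
open import Data.Product using (_,_; ∃-syntax)
open import Data.Rational using (ℚ; 0ℚ; 1ℚ; -_; _/_; toℚᵘ)
  renaming (_+_ to _+ℚ_; _*_ to _*ℚ_)
import Data.Rational.Properties as ℚ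
open import Data.Rational.Solver renaming (module +-*-Solver to ℚ-Solver)
import Data.Rational.Unnormalised as ℚᵘ
import Data.Rational.Unnormalised.Properties as ℚᵘ
open import Data.Sum using (_⊎_; inj₁; inj₂; [_,_])
open import Data.Vec using ([]; _∷_)
open import Function using (_∘_; case_of_)
open import Relation.Binary.PropositionalEquality using (_≡_; refl; sym; trans; cong; cong₂)
open import Relation.Binary.PropositionalEquality.Properties using (module ≡-Reasoning)
open import Relation.Nullary using (does)

open import Algebra.Properties.CommutativeSemigroup
  (CommutativeMonoid.commutativeSemigroup ℚ.+-0-commutativeMonoid) using (interchange)

open import Defs

private
  variable
    A B : Set
    m : ℕ
    x : Bool
    T : Subset m

∑ : (A → ℚ) → List A → ℚ
∑ f xs = sumℚ (map f xs)

∑-cong : {f g : A → ℚ} → (∀ a → f a ≡ g a) → ∀ xs → ∑ f xs ≡ ∑ g xs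
∑-cong f≗g xs = cong sumℚ (map-cong f≗g xs)

∑-0 : {f : A → ℚ} → (∀ a → f a ≡ 0ℚ) → ∀ xs → ∑ f xs ≡ 0ℚ
∑-0 f≗0 []       = refl
∑-0 f≗0 (a ∷ xs) = cong₂ _+ℚ_ (f≗0 a) (∑-0 f≗0 xs)

∑-++ : (f : A → ℚ) → ∀ xs ys → ∑ f (xs ++ ys) ≡ ∑ f xs +ℚ ∑ f ys
∑-++ f []       ys = sym (ℚ.+-identityˡ (∑ f ys))
∑-++ f (a ∷ xs) ys = trans (cong (f a +ℚ_) (∑-++ f xs ys)) (sym (ℚ.+-assoc (f a) _ _))

∑-map : (f : B → ℚ) (g : A → B) → ∀ xs → ∑ f (map g xs) ≡ ∑ (f ∘ g) xs
∑-map f g xs = cong sumℚ (sym (map-∘ xs))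

∑-+ : (f g : A → ℚ) → ∀ xs → ∑ (λ a → f a +ℚ g a) xs ≡ ∑ f xs +ℚ ∑ g xs
∑-+ f g []       = refl
∑-+ f g (a ∷ xs) = trans (cong (f a +ℚ g a +ℚ_) (∑-+ f g xs)) (interchange (f a) (g a) _ _)

∑-*ˡ : (k : ℚ) (f : A → ℚ) → ∀ xs → ∑ (λ a → k *ℚ f a) xs ≡ k *ℚ ∑ f xs
∑-*ˡ k f []       = sym (ℚ.*-zeroʳ k)
∑-*ˡ k f (a ∷ xs) = trans (cong (k *ℚ f a +ℚ_) (∑-*ˡ k f xs)) (sym (ℚ.*-distribˡ-+ k (f a) _))

∑-allSubsets-suc : ∀ x (f : Subset (suc m) → ℚ) →
  ∑ f (allSubsets (suc m)) ≡ ∑ (f ∘ (x ∷_)) (allSubsets m) +ℚ ∑ (f ∘ (not x ∷_)) (allSubsets m)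
∑-allSubsets-suc {m} false f =
  trans (∑-++ f (map (false ∷_) (allSubsets m)) (map (true ∷_) (allSubsets m)))
        (cong₂ _+ℚ_ (∑-map f (false ∷_) (allSubsets m)) (∑-map f (true ∷_) (allSubsets m)))
∑-allSubsets-suc {m} true f =
  trans (∑-allSubsets-suc false f) (ℚ.+-comm (∑ (f ∘ (false ∷_)) (allSubsets m)) _)

q≡0⇒p*q≡0 : ∀ p {q} → q ≡ 0ℚ → p *ℚ q ≡ 0ℚ
q≡0⇒p*q≡0 p refl = ℚ.*-zeroʳ p

fromℕ : ℕ → ℚ
fromℕ k = + k / 1

fromℕ-suc : ∀ k → fromℕ (suc k) ≡ 1ℚ +ℚ fromℕ k
fromℕ-suc k = ℚ.toℚᵘ-injective (begin
  toℚᵘ (fromℕ (suc k))                  ≈⟨ ℚ.toℚᵘ-fromℚᵘ (ℚᵘ.mkℚᵘ (+ suc k) 0) ⟩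
  ℚᵘ.mkℚᵘ (+ suc k) 0                   ≈⟨ ℚᵘ.*≡* (solve 1 (λ z → (con ℤ.1ℤ :+ z) :* con ℤ.1ℤ
                                             := (con ℤ.1ℤ :* con ℤ.1ℤ :+ z :* con ℤ.1ℤ) :* con ℤ.1ℤ) refl (+ k)) ⟩
  ℚᵘ.1ℚᵘ ℚᵘ.+ ℚᵘ.mkℚᵘ (+ k) 0           ≈⟨ ℚᵘ.+-congʳ ℚᵘ.1ℚᵘ (ℚᵘ.≃-sym (ℚ.toℚᵘ-fromℚᵘ (ℚᵘ.mkℚᵘ (+ k) 0))) ⟩
  toℚᵘ 1ℚ ℚᵘ.+ toℚᵘ (fromℕ k)           ≈⟨ ℚᵘ.≃-sym (ℚ.toℚᵘ-homo-+ 1ℚ (fromℕ k)) ⟩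
  toℚᵘ (1ℚ +ℚ fromℕ k)                  ∎)
  where open ℚᵘ.≃-Reasoning; open ℤ-Solver

δ : ABWord → ABWord → ℚ
δ v u = if does (≡-dec Bool._≟_ v u) then 1ℚ else 0ℚ

δ-∷ : ∀ x v u → δ (x ∷ v) (x ∷ u) ≡ δ v u
δ-∷ false v u = refl
δ-∷ true  v u = refl

δ-∷-not : ∀ x v u → δ (x ∷ v) (not x ∷ u) ≡ 0ℚ
δ-∷-not false v u = refl
δ-∷-not true  v u = refl

fromℕ-occ-∷ : ∀ u v vs → fromℕ (occ u (v ∷ vs)) ≡ δ v u +ℚ fromℕ (occ u vs)
fromℕ-occ-∷ u v vs with does (≡-dec Bool._≟_ v u)
... | true  = fromℕ-suc (occ u vs)
... | false = sym (ℚ.+-identityˡ _)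

sign : Bool → ℚ
sign false = 1ℚ
sign true  = - 1ℚ

letterWeight : Bool → Bool → ℚ
letterWeight t false = 1ℚ
letterWeight t true  = sign t

-- The substitution a ↦ 1, b ↦ (−1)^[i ∈ T] at position i.
abWeight : Subset m → ABWord → ℚ
abWeight []      []      = 1ℚ
abWeight []      (_ ∷ _) = 0ℚ
abWeight (_ ∷ _) []      = 0ℚ
abWeight (t ∷ T) (x ∷ u) = letterWeight t x *ℚ abWeight T u

cdWeight : Subset m → CDWord → ℚ
cdWeight T w = ∑ (abWeight T) (expand w)

sgn-∣∩∣ : (S T : Subset m) → sgn ∣ S ∩ T ∣ ≡ abWeight T (uS S)
sgn-∣∩∣ []          []          = refl
sgn-∣∩∣ (false ∷ S) (t ∷ T)     = trans (sgn-∣∩∣ S T) (sym (ℚ.*-identityˡ _))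
sgn-∣∩∣ (true ∷ S)  (false ∷ T) = trans (sgn-∣∩∣ S T) (sym (ℚ.*-identityˡ _))
sgn-∣∩∣ (true ∷ S)  (true ∷ T)  = begin
  - sgn ∣ S ∩ T ∣            ≡⟨ cong -_ (trans (sgn-∣∩∣ S T) (sym (ℚ.*-identityˡ _))) ⟩
  - (1ℚ *ℚ abWeight T (uS S)) ≡⟨ ℚ.neg-distribˡ-* 1ℚ (abWeight T (uS S)) ⟩
  - 1ℚ *ℚ abWeight T (uS S)  ∎
  where open ≡-Reasoning

∑-abWeight-δ : (T : Subset m) → ∀ u →
  ∑ (λ S → abWeight T (uS S) *ℚ δ u (uS S)) (allSubsets m) ≡ abWeight T u
∑-abWeight-δ []      []      = refl
∑-abWeight-δ []      (_ ∷ _) = refl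
∑-abWeight-δ {suc m} (t ∷ T) [] =
  ∑-0 (λ { (y ∷ S) → ℚ.*-zeroʳ (abWeight (t ∷ T) (y ∷ uS S)) }) (allSubsets (suc m))
∑-abWeight-δ {suc m} (t ∷ T) (x ∷ u) = begin
  ∑ f (allSubsets (suc m))
    ≡⟨ ∑-allSubsets-suc x f ⟩
  ∑ (f ∘ (x ∷_)) (allSubsets m) +ℚ ∑ (f ∘ (not x ∷_)) (allSubsets m)
    ≡⟨ cong₂ _+ℚ_ (∑-cong matching (allSubsets m)) (∑-0 mismatching (allSubsets m)) ⟩
  ∑ (λ S → letterWeight t x *ℚ g S) (allSubsets m) +ℚ 0ℚ
    ≡⟨ ℚ.+-identityʳ _ ⟩
  ∑ (λ S → letterWeight t x *ℚ g S) (allSubsets m)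
    ≡⟨ ∑-*ˡ (letterWeight t x) g (allSubsets m) ⟩
  letterWeight t x *ℚ ∑ g (allSubsets m)
    ≡⟨ cong (letterWeight t x *ℚ_) (∑-abWeight-δ T u) ⟩
  letterWeight t x *ℚ abWeight T u
    ∎
  where
  open ≡-Reasoning
  f : Subset (suc m) → ℚ
  f S = abWeight (t ∷ T) (uS S) *ℚ δ (x ∷ u) (uS S)
  g : Subset m → ℚ
  g S = abWeight T (uS S) *ℚ δ u (uS S)
  matching : ∀ S → f (x ∷ S) ≡ letterWeight t x *ℚ g S
  matching S = trans (cong (letterWeight t x *ℚ abWeight T (uS S) *ℚ_) (δ-∷ x u (uS S)))
    (ℚ.*-assoc (letterWeight t x) (abWeight T (uS S)) (δ u (uS S)))
  mismatching : ∀ S → f (not x ∷ S) ≡ 0ℚ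
  mismatching S = q≡0⇒p*q≡0 (abWeight (t ∷ T) (not x ∷ uS S)) (δ-∷-not x u (uS S))

∑-abWeight-occ : (T : Subset m) → ∀ vs →
  ∑ (λ S → abWeight T (uS S) *ℚ fromℕ (occ (uS S) vs)) (allSubsets m) ≡ ∑ (abWeight T) vs
∑-abWeight-occ {m} T [] = ∑-0 (λ S → ℚ.*-zeroʳ (abWeight T (uS S))) (allSubsets m)
∑-abWeight-occ {m} T (v ∷ vs) = begin
  ∑ (λ S → a S *ℚ fromℕ (occ (uS S) (v ∷ vs))) (allSubsets m)
    ≡⟨ ∑-cong (λ S → trans (cong (a S *ℚ_) (fromℕ-occ-∷ (uS S) v vs))
                           (ℚ.*-distribˡ-+ (a S) (δ v (uS S)) _)) (allSubsets m) ⟩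
  ∑ (λ S → a S *ℚ δ v (uS S) +ℚ a S *ℚ fromℕ (occ (uS S) vs)) (allSubsets m)
    ≡⟨ ∑-+ (λ S → a S *ℚ δ v (uS S)) (λ S → a S *ℚ fromℕ (occ (uS S) vs)) (allSubsets m) ⟩
  ∑ (λ S → a S *ℚ δ v (uS S)) (allSubsets m) +ℚ ∑ (λ S → a S *ℚ fromℕ (occ (uS S) vs)) (allSubsets m)
    ≡⟨ cong₂ _+ℚ_ (∑-abWeight-δ T v) (∑-abWeight-occ T vs) ⟩
  abWeight T v +ℚ ∑ (abWeight T) vs
    ∎
  where
  open ≡-Reasoning
  a : Subset m → ℚ
  a S = abWeight T (uS S)

∑-abWeight-coeffAB : (T : Subset m) → ∀ P →
  ∑ (λ S → abWeight T (uS S) *ℚ coeffAB P (uS S)) (allSubsets m) ≡ ∑ (λ (q , w) → q *ℚ cdWeight T w) P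
∑-abWeight-coeffAB {m} T [] = ∑-0 (λ S → ℚ.*-zeroʳ (abWeight T (uS S))) (allSubsets m)
∑-abWeight-coeffAB {m} T ((q , w) ∷ P) = begin
  ∑ (λ S → a S *ℚ (q *ℚ o S +ℚ r S)) (allSubsets m)
    ≡⟨ ∑-cong (λ S → distrib (a S) q (o S) (r S)) (allSubsets m) ⟩
  ∑ (λ S → q *ℚ (a S *ℚ o S) +ℚ a S *ℚ r S) (allSubsets m)
    ≡⟨ ∑-+ (λ S → q *ℚ (a S *ℚ o S)) (λ S → a S *ℚ r S) (allSubsets m) ⟩
  ∑ (λ S → q *ℚ (a S *ℚ o S)) (allSubsets m) +ℚ ∑ (λ S → a S *ℚ r S) (allSubsets m)
    ≡⟨ cong₂ _+ℚ_ (trans (∑-*ˡ q (λ S → a S *ℚ o S) (allSubsets m))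
                         (cong (q *ℚ_) (∑-abWeight-occ T (expand w))))
                  (∑-abWeight-coeffAB T P) ⟩
  q *ℚ cdWeight T w +ℚ ∑ (λ (q , w) → q *ℚ cdWeight T w) P
    ∎
  where
  open ≡-Reasoning
  a o r : Subset m → ℚ
  a S = abWeight T (uS S)
  o S = fromℕ (occ (uS S) (expand w))
  r S = coeffAB P (uS S)
  distrib : ∀ a q o r → a *ℚ (q *ℚ o +ℚ r) ≡ q *ℚ (a *ℚ o) +ℚ a *ℚ r
  distrib = solve 4 (λ a q o r → a :* (q :* o :+ r) := q :* (a :* o) :+ a :* r) refl
    where open ℚ-Solver

∑-abWeight-∷ : ∀ t x (T : Subset m) us →
  ∑ (abWeight (t ∷ T)) (map (x ∷_) us) ≡ letterWeight t x *ℚ ∑ (abWeight T) us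
∑-abWeight-∷ t x T us = trans (∑-map _ (x ∷_) us) (∑-*ˡ (letterWeight t x) (abWeight T) us)

cdWeight-c : ∀ x (T : Subset m) w → cdWeight (x ∷ T) (c ∷ w) ≡ (1ℚ +ℚ sign x) *ℚ cdWeight T w
cdWeight-c x T w = begin
  ∑ (abWeight (x ∷ T)) (map (false ∷_) (expand w) ++ map (true ∷_) (expand w))
    ≡⟨ ∑-++ (abWeight (x ∷ T)) (map (false ∷_) (expand w)) (map (true ∷_) (expand w)) ⟩
  ∑ (abWeight (x ∷ T)) (map (false ∷_) (expand w)) +ℚ ∑ (abWeight (x ∷ T)) (map (true ∷_) (expand w))
    ≡⟨ cong₂ _+ℚ_ (∑-abWeight-∷ x false T (expand w)) (∑-abWeight-∷ x true T (expand w)) ⟩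
  1ℚ *ℚ cdWeight T w +ℚ sign x *ℚ cdWeight T w
    ≡⟨ ℚ.*-distribʳ-+ (cdWeight T w) 1ℚ (sign x) ⟨
  (1ℚ +ℚ sign x) *ℚ cdWeight T w
    ∎
  where open ≡-Reasoning

cdWeight-d : ∀ x y (T : Subset m) w → cdWeight (x ∷ y ∷ T) (d ∷ w) ≡ (sign y +ℚ sign x) *ℚ cdWeight T w
cdWeight-d x y T w = begin
  ∑ (abWeight (x ∷ y ∷ T)) (map (λ u → false ∷ true ∷ u) (expand w) ++ map (λ u → true ∷ false ∷ u) (expand w))
    ≡⟨ ∑-++ (abWeight (x ∷ y ∷ T)) (map (λ u → false ∷ true ∷ u) (expand w))
            (map (λ u → true ∷ false ∷ u) (expand w)) ⟩
  ∑ (abWeight (x ∷ y ∷ T)) (map (λ u → false ∷ true ∷ u) (expand w)) +ℚ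
  ∑ (abWeight (x ∷ y ∷ T)) (map (λ u → true ∷ false ∷ u) (expand w))
    ≡⟨ cong₂ _+ℚ_ (pair false true) (pair true false) ⟩
  1ℚ *ℚ (sign y *ℚ cdWeight T w) +ℚ sign x *ℚ (1ℚ *ℚ cdWeight T w)
    ≡⟨ solve 3 (λ sx sy e → con 1ℚ :* (sy :* e) :+ sx :* (con 1ℚ :* e) := (sy :+ sx) :* e) refl
             (sign x) (sign y) (cdWeight T w) ⟩
  (sign y +ℚ sign x) *ℚ cdWeight T w
    ∎
  where
  open ≡-Reasoning
  open ℚ-Solver
  pair : ∀ a b → ∑ (abWeight (x ∷ y ∷ T)) (map (λ u → a ∷ b ∷ u) (expand w))
                 ≡ letterWeight x a *ℚ (letterWeight y b *ℚ cdWeight T w)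
  pair a b = trans (∑-map _ (λ u → a ∷ b ∷ u) (expand w))
    (trans (∑-*ˡ (letterWeight x a) (λ u → letterWeight y b *ℚ abWeight T u) (expand w))
           (cong (letterWeight x a *ℚ_) (∑-*ˡ (letterWeight y b) (abWeight T) (expand w))))

cdWeight-d-last : ∀ x w → cdWeight (x ∷ []) (d ∷ w) ≡ 0ℚ
cdWeight-d-last x w =
  trans (∑-++ (abWeight (x ∷ [])) (map (λ u → false ∷ true ∷ u) (expand w))
                                  (map (λ u → true ∷ false ∷ u) (expand w)))
        (cong₂ _+ℚ_ (dangling false true) (dangling true false))
  where
  dangling : ∀ a b → ∑ (abWeight (x ∷ [])) (map (λ u → a ∷ b ∷ u) (expand w)) ≡ 0ℚ
  dangling a b = trans (∑-map (abWeight (x ∷ [])) (λ u → a ∷ b ∷ u) (expand w))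
                       (∑-0 (λ u → ℚ.*-zeroʳ (letterWeight x a)) (expand w))

-- OddRunThenGap T: T begins with an odd block of trues followed by a false or by the end
-- of T.  LaterOddRunThenGap T: such a block begins at a position ≥ 2, right after a false.
data EvenRunThenGap : Subset m → Set where
  at-end      : EvenRunThenGap []
  at-gap      : EvenRunThenGap (false ∷ T)
  true∷true∷_ : EvenRunThenGap T → EvenRunThenGap (true ∷ true ∷ T)

data OddRunThenGap : Subset m → Set where
  true∷_ : EvenRunThenGap T → OddRunThenGap (true ∷ T)

data LaterOddRunThenGap : Subset m → Set where
  false∷_ : OddRunThenGap T → LaterOddRunThenGap (false ∷ T)
  _∷_     : ∀ x → LaterOddRunThenGap T → LaterOddRunThenGap (x ∷ T)

IsolatedOddRun : Subset m → Set
IsolatedOddRun T = OddRunThenGap T ⊎ LaterOddRunThenGap T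

cdWeight-oddRun : OddRunThenGap T → ∀ w → cdWeight T w ≡ 0ℚ
cdWeight-oddRun (true∷ _) [] = refl
cdWeight-oddRun {T = true ∷ T} (true∷ _) (c ∷ w) = trans (cdWeight-c true T w) (ℚ.*-zeroˡ (cdWeight T w))
cdWeight-oddRun (true∷ at-end) (d ∷ w) = cdWeight-d-last true w
cdWeight-oddRun {T = true ∷ false ∷ T} (true∷ at-gap) (d ∷ w) =
  trans (cdWeight-d true false T w) (ℚ.*-zeroˡ (cdWeight T w))
cdWeight-oddRun {T = true ∷ true ∷ T} (true∷ (true∷true∷ r)) (d ∷ w) =
  trans (cdWeight-d true true T w) (q≡0⇒p*q≡0 (sign true +ℚ sign true) (cdWeight-oddRun (true∷ r) w))

cdWeight-laterOddRun : LaterOddRunThenGap T → ∀ w → cdWeight T w ≡ 0ℚ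
cdWeight-laterOddRun (false∷ _) [] = refl
cdWeight-laterOddRun (_ ∷ _)    [] = refl
cdWeight-laterOddRun {T = false ∷ T} (false∷ r) (c ∷ w) =
  trans (cdWeight-c false T w) (q≡0⇒p*q≡0 (1ℚ +ℚ sign false) (cdWeight-oddRun r w))
cdWeight-laterOddRun {T = false ∷ true ∷ T} (false∷ (true∷ _)) (d ∷ w) =
  trans (cdWeight-d false true T w) (ℚ.*-zeroˡ (cdWeight T w))
cdWeight-laterOddRun {T = x ∷ T} (x ∷ r) (c ∷ w) =
  trans (cdWeight-c x T w) (q≡0⇒p*q≡0 (1ℚ +ℚ sign x) (cdWeight-laterOddRun r w))
cdWeight-laterOddRun {T = x ∷ false ∷ T} (x ∷ (false∷ r)) (d ∷ w) =
  trans (cdWeight-d x false T w) (q≡0⇒p*q≡0 (sign false +ℚ sign x) (cdWeight-oddRun r w))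
cdWeight-laterOddRun {T = x ∷ y ∷ T} (x ∷ (y ∷ r)) (d ∷ w) =
  trans (cdWeight-d x y T w) (q≡0⇒p*q≡0 (sign y +ℚ sign x) (cdWeight-laterOddRun r w))

cdWeight-isolatedOddRun : IsolatedOddRun T → ∀ w → cdWeight T w ≡ 0ℚ
cdWeight-isolatedOddRun = [ cdWeight-oddRun , cdWeight-laterOddRun ]

Run : Subset m → ℕ → ℕ → Set
Run T s t = ∀ i → s ≤ i → i ≤ t → elem T i ≡ true

Run-tail : ∀ {s t} → Run (x ∷ T) (suc (suc s)) (suc t) → Run T (suc s) t
Run-tail run (suc i) (s≤s s≤i) i≤t = run (suc (suc i)) (s≤s (s≤s s≤i)) (s≤s i≤t)

Run-tail₁ : ∀ {t} → Run (x ∷ T) 1 (suc t) → Run T 1 t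
Run-tail₁ run (suc i) (s≤s z≤n) i≤t = run (suc (suc i)) (s≤s z≤n) (s≤s i≤t)

evenRunThenGap : (T : Subset m) → ∀ k {u} → u ≡ 2 * k → Run T 1 u → elem T (suc u) ≡ false →
  EvenRunThenGap T
evenRunThenGap []          _       _    _   _  = at-end
evenRunThenGap (false ∷ T) _       _    _   _  = at-gap
evenRunThenGap (true ∷ T)  zero    refl _   ()
evenRunThenGap (true ∷ T)  (suc k) u≡2k run gap with trans u≡2k (ℕ.*-suc 2 k)
... | refl with run 2 (s≤s z≤n) (s≤s (s≤s z≤n))
evenRunThenGap (true ∷ true ∷ T) (suc k) _ run gap | refl | _ =
  true∷true∷ evenRunThenGap T k refl (Run-tail₁ (Run-tail₁ run)) gap
evenRunThenGap (true ∷ [])        (suc k) _ run gap | refl | ()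
evenRunThenGap (true ∷ false ∷ T) (suc k) _ run gap | refl | ()

oddRunThenGap : (T : Subset m) → ∀ k {t} → t ≡ suc (2 * k) → Run T 1 t → elem T (suc t) ≡ false →
  OddRunThenGap T
oddRunThenGap []          _ refl run _     = case run 1 (s≤s z≤n) (s≤s z≤n) of λ ()
oddRunThenGap (false ∷ T) _ refl run _     = case run 1 (s≤s z≤n) (s≤s z≤n) of λ ()
oddRunThenGap (true ∷ T)  k refl run after = true∷ evenRunThenGap T k refl (Run-tail₁ run) after

laterOddRunThenGap : (T : Subset m) → ∀ s {t} → suc (suc s) ≤ t → ∃[ k ] (suc t ∸ suc (suc s) ≡ suc (2 * k)) →
  Run T (suc (suc s)) t → elem T (suc s) ≡ false → elem T (suc t) ≡ false → LaterOddRunThenGap T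
laterOddRunThenGap [] s s≤t _ run _ _ = case run (suc (suc s)) ℕ.≤-refl s≤t of λ ()
laterOddRunThenGap (true ∷ T) zero _ _ _ () _
laterOddRunThenGap (false ∷ T) zero (s≤s (s≤s _)) (k , odd) run _ after =
  false∷ oddRunThenGap T k odd (Run-tail run) after
laterOddRunThenGap (x ∷ T) (suc s) (s≤s s≤t) odd run before after =
  x ∷ laterOddRunThenGap T s s≤t odd (Run-tail run) before after

isolatedOddRun : (T : Subset m) → ∀ s t → 1 ≤ s → s ≤ t → ∃[ k ] (suc t ∸ s ≡ suc (2 * k)) →
  Run T s t → elem T (pred s) ≡ false → elem T (suc t) ≡ false → IsolatedOddRun T
isolatedOddRun T 1 t _ _ (k , odd) run _ after = inj₁ (oddRunThenGap T k odd run after)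
isolatedOddRun T (suc (suc s)) t _ s≤t odd run before after =
  inj₂ (laterOddRunThenGap T s s≤t odd run before after)

proposition7p2 : (n : ℕ) → 1 ≤ n →
    (h : Subset (n ∸ 1) → ℚ) → InGDS (n ∸ 1) h →
    (T : Subset (n ∸ 1)) →
    (s t : ℕ) → 1 ≤ s → s ≤ t → ∃[ k ] (suc t ∸ s ≡ suc (2 * k)) →
    ((i : ℕ) → s ≤ i → i ≤ t → elem T i ≡ true) →
    elem T (pred s) ≡ false → elem T (suc t) ≡ false →
    sumℚ (map (λ S → sgn ∣ S ∩ T ∣ *ℚ h S) (allSubsets (n ∸ 1))) ≡ 0ℚ
proposition7p2 n _ h (P , P≡h , _) T s t 1≤s s≤t odd run before after = begin
  ∑ (λ S → sgn ∣ S ∩ T ∣ *ℚ h S) (allSubsets (n ∸ 1))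
    ≡⟨ ∑-cong (λ S → cong₂ _*ℚ_ (sgn-∣∩∣ S T) (sym (P≡h S))) (allSubsets (n ∸ 1)) ⟩
  ∑ (λ S → abWeight T (uS S) *ℚ coeffAB P (uS S)) (allSubsets (n ∸ 1))
    ≡⟨ ∑-abWeight-coeffAB T P ⟩
  ∑ (λ (q , w) → q *ℚ cdWeight T w) P
    ≡⟨ ∑-0 (λ (q , w) → q≡0⇒p*q≡0 q (cdWeight-isolatedOddRun isolated w)) P ⟩
  0ℚ
    ∎
  where
  open ≡-Reasoning
  isolated : IsolatedOddRun T
  isolated = isolatedOddRun T s t 1≤s s≤t odd run before after
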